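{- If a CLD-formula is satisfied in a finite pseudomodel, then it is satisfied in a model.
   Context: Let $N$ be a finite set of agents and $\Theta$ a set of atomic propositions. CLD-formulas: $\phi ::= p \mid \neg\phi \mid \phi\wedge\phi \mid [H]\phi \mid K_i\phi \mid D_G\phi$ ($H\subseteq N$, $\emptyset\neq G\subseteq N$). An effectivity function $E$ on $S$ is truly playable if for all $s$: (E1) $\emptyset\notin E(G)(s)$; (E2) $S\in E(G)(s)$; (E3) $S\setminus X\notin E(\emptyset)(s)\Rightarrow X\in E(N)(s)$; (E4) if $X\subseteq Y$ and $X\in E(G)(s)$ then $Y\in E(G)(s)$; (E5) $X\in E(G_1)(s)$, $Y\in E(G_2)(s)$, $G_1\cap G_2=\emptyset$ imply $X\cap Y\in E(G_1\cup G_2)(s)$; (E6) the set of $\subseteq$-minimal elements of $E(\emptyset)(s)$ is non-empty. A model is $\langle S,E,\sim_1,\ldots,\sim_n,V\rangle$ with $S$ non-empty, $V$ a valuation, $\sim_i$ equivalence relations and $E$ truly playable; there $M,s\models D_G\phi$ iff $\phi$ holds at every $t$ with $(s,t)\in\bigcap_{i\in G}\sim_i$. A pseudomodel is $(S,\{\sim_i\},\{R_G:\emptyset\neq G\subseteq N\},E,V)$ where $(S,E,\{\sim_i\},V)$ is a model, each $R_G$ is an equivalence relation, $R_{\{i\}}=\sim_i$, and $G\subseteq H\Rightarrow R_H\subseteq R_G$; in a pseudomodel $D_G\phi$ is instead interpreted via $R_G$. In both, $M,s\models[G]\phi$ iff $\{t:M,t\models\phi\}\in E(G)(s)$ and $K_i\phi$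 is interpreted via $\sim_i$. -}

module Defs where

open import Data.Nat using (ℕ)
open import Data.Fin using (Fin)
open import Data.Fin.Subset using (Subset; _∈_; _⊆_; _∩_; _∪_; ⁅_⁆; Nonempty; Empty)
  renaming (⊥ to ∅ₛ; ⊤ to Allₛ)
open import Data.Product using (Σ; ∃; _×_; _,_)
open import Data.Empty using (⊥)
open import Data.Unit using (⊤)
open import Relation.Nullary using (¬_)
open import Relation.Binary.Structures using (IsEquivalence)

-- Agents: N = Fin n.  Coalitions: Subset n.  Atoms: an arbitrary type Θ.
-- Sets of states: predicates S → Set.

data Fm (n : ℕ) (Θ : Set) : Set where
  atom : Θ → Fm n Θ
  ¬'_  : Fm n Θ → Fm n Θ
  _∧'_ : Fm n Θ → Fm n Θ → Fm n Θ
  [_]_ : Subset n → Fm n Θ → Fm n Θ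
  K    : Fin n → Fm n Θ → Fm n Θ
  D    : (G : Subset n) → Nonempty G → Fm n Θ → Fm n Θ

StSet : Set → Set₁
StSet S = S → Set

_⊆ₚ_ : {S : Set} → StSet S → StSet S → Set
X ⊆ₚ Y = ∀ t → X t → Y t

emptyₚ : {S : Set} → StSet S
emptyₚ _ = ⊥

fullₚ : {S : Set} → StSet S
fullₚ _ = ⊤

complₚ : {S : Set} → StSet S → StSet S
complₚ X t = ¬ X t

_∩ₚ_ : {S : Set} → StSet S → StSet S → StSet S
(X ∩ₚ Y) t = X t × Y t

EffFun : ℕ → Set → Set₁
EffFun n S = Subset n → S → StSet S → Set

record TrulyPlayable {n : ℕ} {S : Set} (E : EffFun n S) : Set₁ where
  field
    E1 : ∀ G s → ¬ E G s emptyₚ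
    E2 : ∀ G s → E G s fullₚ
    E3 : ∀ s X → ¬ E ∅ₛ s (complₚ X) → E Allₛ s X
    E4 : ∀ G s X Y → X ⊆ₚ Y → E G s X → E G s Y
    E5 : ∀ G₁ G₂ s X Y → E G₁ s X → E G₂ s Y → Empty (G₁ ∩ G₂) →
         E (G₁ ∪ G₂) s (X ∩ₚ Y)
    E6 : ∀ s → Σ (StSet S) λ X → E ∅ₛ s X ×
         (∀ Y → E ∅ₛ s Y → Y ⊆ₚ X → X ⊆ₚ Y)

record ModelStr (n : ℕ) (Θ : Set) (S : Set) : Set₁ where
  field
    inhabitant : S
    E     : EffFun n S
    ∼     : Fin n → S → S → Set
    V     : Θ → StSet S
    ∼-equiv  : ∀ i → IsEquivalence (∼ i)
    playable : TrulyPlayable E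

record Model (n : ℕ) (Θ : Set) : Set₁ where
  field
    St  : Set
    str : ModelStr n Θ St
  open ModelStr str public

record Pseudomodel (n : ℕ) (Θ : Set) (S : Set) : Set₁ where
  field
    str : ModelStr n Θ S
    R   : Subset n → S → S → Set
    R-equiv : ∀ G → Nonempty G → IsEquivalence (R G)
    R-single-⊆ : ∀ i s t → R ⁅ i ⁆ s t → ModelStr.∼ str i s t
    R-single-⊇ : ∀ i s t → ModelStr.∼ str i s t → R ⁅ i ⁆ s t
    R-anti : ∀ G H → Nonempty G → Nonempty H → G ⊆ H →
             ∀ s t → R H s t → R G s t
  open ModelStr str public

-- satisfaction, parametrised by the relation used to interpret D_G
sat : {n : ℕ} {Θ : Set} {S : Set} → ModelStr n Θ S →
      (Subset n → S → S → Set) → S → Fm n Θ → Set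
sat M rel s (atom p)  = ModelStr.V M p s
sat M rel s (¬' φ)    = ¬ sat M rel s φ
sat M rel s (φ ∧' ψ)  = sat M rel s φ × sat M rel s ψ
sat M rel s ([ H ] φ) = ModelStr.E M H s (λ t → sat M rel t φ)
sat M rel s (K i φ)   = ∀ t → ModelStr.∼ M i s t → sat M rel t φ
sat M rel s (D G _ φ) = ∀ t → rel G s t → sat M rel t φ

distRel : {n : ℕ} {S : Set} → (Fin n → S → S → Set) → Subset n → S → S → Set
distRel ∼ G s t = ∀ i → i ∈ G → ∼ i s t

_⊨M_at_ : {n : ℕ} {Θ : Set} (M : Model n Θ) → Fm n Θ → Model.St M → Set
M ⊨M φ at s = sat (Model.str M) (distRel (Model.∼ M)) s φ

_⊨P_at_ : {n : ℕ} {Θ : Set} {S : Set} (P : Pseudomodel n Θ S) → Fm n Θ → S → Set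
P ⊨P φ at s = sat (Pseudomodel.str P) (Pseudomodel.R P) s φ

module Submission where

-- A pseudomodel P differs from a model only in that D_G is read through an
-- abstract equivalence R_G instead of the intersection of the ∼ᵢ (i ∈ G).
-- We turn P into a model by unravelling it into paths
--     r —(H₁,t₁)→ t₁ —(H₂,t₂)→ … —(Hₖ,tₖ)→ tₖ      with R_{Hⱼ}(tⱼ₋₁, tⱼ),
-- where two paths are i-indistinguishable when they start at the same state
-- and, after a common prefix, use only steps whose coalition contains i.
-- Then every ∼ᵢ is an equivalence (Diverge-isEquivalence below), and paths
-- indistinguishable for all i ∈ G have R_G-related end points: strip the
-- longest common prefix and walk along the remaining G-labelled steps, using
-- R_H ⊆ R_G for G ⊆ H.  Conversely every R_G-step can be mirrored by extending
-- the path.  Effectivity at a path is that of P at its end point, restricted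
-- to paths of length 0; this is again truly playable.  A truth lemma by
-- induction on formulas then shows that a path satisfies φ exactly when its
-- end point does in P.  Finiteness of P is used only through decidable
-- equality of states (needed to compute the longest common prefix).

open import Defs
open import Data.Nat using (ℕ)
open import Data.Fin using (Fin)
open import Data.Product using (Σ; ∃; _×_; _,_; proj₁; proj₂)
open import Data.Sum using (_⊎_; inj₁; inj₂)
open import Data.Unit using (⊤; tt)
open import Data.Empty using (⊥-elim)
open import Data.List using (List; []; _∷_; _++_; [_])
open import Data.List.Properties using (∷-injective; ++-assoc; ++-identityʳ)
open import Data.List.Relation.Unary.All using (All; []; _∷_; head; tail)
open import Data.List.Relation.Unary.All.Properties using (++⁺; ++⁻ˡ; ++⁻ʳ)
open import Data.Fin.Subset using (Subset; _∈_; _⊆_; Nonempty; ⁅_⁆)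
  renaming (⊥ to ∅ₛ)
open import Data.Fin.Subset.Properties using (x∈⁅x⁆; x∈⁅y⁆⇒x≡y)
open import Function.Bundles using (_⇔_; mk⇔; Equivalence)
open import Relation.Nullary using (yes; no)
open import Relation.Binary.Definitions using (DecidableEquality)
open import Relation.Binary.PropositionalEquality hiding ([_])
open import Relation.Binary.Structures using (IsEquivalence)
import Data.Bool as Bool
import Data.Fin as Fin
import Data.Vec.Properties as Vec
import Data.Product.Properties as Product

open Equivalence using (to; from)

module _ {A : Set} where

  ++-prefixes : (c c' a b : List A) → c ++ a ≡ c' ++ b →
    (∃ λ d → c' ≡ c ++ d × a ≡ d ++ b) ⊎ (∃ λ d → c ≡ c' ++ d × b ≡ d ++ a)
  ++-prefixes []      c'       a b eq = inj₁ (c' , refl , eq)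
  ++-prefixes (x ∷ c) []       a b eq = inj₂ (x ∷ c , refl , sym eq)
  ++-prefixes (x ∷ c) (y ∷ c') a b eq with ∷-injective eq
  ... | refl , eq' with ++-prefixes c c' a b eq'
  ... | inj₁ (d , p , q) = inj₁ (d , cong (x ∷_) p , q)
  ... | inj₂ (d , p , q) = inj₂ (d , cong (x ∷_) p , q)

  record Diverge (Q : A → Set) (xs ys : List A) : Set where
    constructor fork
    field
      stem left right : List A
      xs≡ : xs ≡ stem ++ left
      ys≡ : ys ≡ stem ++ right
      all-left  : All Q left
      all-right : All Q right

  Diverge-isEquivalence : (Q : A → Set) → IsEquivalence (Diverge Q)
  Diverge-isEquivalence Q = record
    { refl  = λ {xs} → fork xs [] [] (sym (++-identityʳ xs)) (sym (++-identityʳ xs)) [] []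
    ; sym   = λ (fork c us vs p q a b) → fork c vs us q p b a
    ; trans = diverge-trans }
    where
    diverge-trans : ∀ {xs ys zs} → Diverge Q xs ys → Diverge Q ys zs → Diverge Q xs zs
    diverge-trans (fork c us vs refl q a b) (fork c' vs' ws q' refl a' b')
      with ++-prefixes c c' vs vs' (trans (sym q) q')
    ... | inj₁ (d , refl , refl) =
      fork c us (d ++ ws) refl (++-assoc c d ws) a (++⁺ (++⁻ˡ d b) b')
    ... | inj₂ (d , refl , refl) =
      fork c' (d ++ us) ws (++-assoc c' d us) refl (++⁺ (++⁻ˡ d a') a) b'

module _ {A : Set} (_≟_ : DecidableEquality A) where

  strip : List A → List A → List A × List A
  strip []       ys       = [] , ys
  strip (x ∷ xs) []       = x ∷ xs , []
  strip (x ∷ xs) (y ∷ ys) with x ≟ y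
  ... | yes _ = strip xs ys
  ... | no _  = x ∷ xs , y ∷ ys

  strip-++ : ∀ c xs ys → strip (c ++ xs) (c ++ ys) ≡ strip xs ys
  strip-++ []      xs ys = refl
  strip-++ (x ∷ c) xs ys with x ≟ x
  ... | yes _ = strip-++ c xs ys
  ... | no x≢x = ⊥-elim (x≢x refl)

  strip-prefix : ∀ xs ys →
    ∃ λ d → xs ≡ d ++ proj₁ (strip xs ys) × ys ≡ d ++ proj₂ (strip xs ys)
  strip-prefix []       ys       = [] , refl , refl
  strip-prefix (x ∷ xs) []       = [] , refl , refl
  strip-prefix (x ∷ xs) (y ∷ ys) with x ≟ y
  ... | no _ = [] , refl , refl
  ... | yes refl with strip-prefix xs ys
  ... | d , p , q = x ∷ d , cong (x ∷_) p , cong (x ∷_) q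

  -- Any divergence can be read off the longest common prefix: the stripped
  -- remainders are suffixes of the remainders of an arbitrary stem.
  Diverge⇒strip : ∀ {Q : A → Set} xs ys → Diverge Q xs ys →
    All Q (proj₁ (strip xs ys)) × All Q (proj₂ (strip xs ys))
  Diverge⇒strip {Q} _ _ (fork c us vs refl refl a b)
    rewrite strip-++ c us vs with strip-prefix us vs
  ... | d , p , q = ++⁻ʳ d (subst (All Q) p a) , ++⁻ʳ d (subst (All Q) q b)

module Unravelling {n : ℕ} {Θ : Set} {S : Set} (_≟S_ : DecidableEquality S)
                   (P : Pseudomodel n Θ S) where
  open Pseudomodel P
  open TrulyPlayable playable

  Step : Set
  Step = Subset n × S

  _≟Step_ : DecidableEquality Step
  _≟Step_ = Product.≡-dec (Vec.≡-dec Bool._≟_) _≟S_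

  end : S → List Step → S
  end r []             = r
  end r ((_ , t) ∷ xs) = end t xs

  IsPath : S → List Step → Set
  IsPath r []             = ⊤
  IsPath r ((H , t) ∷ xs) = Nonempty H × R H r t × IsPath t xs

  record Node : Set where
    constructor node
    field
      start : S
      steps : List Step
      path  : IsPath start steps
  open Node using (start; steps)

  last : Node → S
  last u = end (start u) (steps u)

  root : S → Node
  root t = node t [] tt

  Labelled : Fin n → Step → Set
  Labelled i (H , _) = i ∈ H

  ∼ₙ : Fin n → Node → Node → Set
  ∼ₙ i u v = start u ≡ start v × Diverge (Labelled i) (steps u) (steps v)

  ∼-isEquivalence : ∀ i → IsEquivalence (∼ₙ i)
  ∼-isEquivalence i = record
    { refl  = refl , D.refl
    ; sym   = λ (p , q) → sym p , D.sym q
    ; trans = λ (p , q) (p' , q') → trans p p' , D.trans q q' }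
    where module D = IsEquivalence (Diverge-isEquivalence (Labelled i))

  R-along : ∀ G → Nonempty G → ∀ r xs → IsPath r xs →
            All (λ e → G ⊆ proj₁ e) xs → R G r (end r xs)
  R-along G ne r []             _              []          = IsEquivalence.refl (R-equiv G ne)
  R-along G ne r ((H , t) ∷ xs) (neH , rH , p) (G⊆H ∷ all) =
    IsEquivalence.trans (R-equiv G ne) (R-anti G H ne neH G⊆H r t rH) (R-along G ne t xs p all)

  R-along-suffix : ∀ G → Nonempty G → ∀ r d xs → IsPath r (d ++ xs) →
                   All (λ e → G ⊆ proj₁ e) xs → R G (end r d) (end r (d ++ xs))
  R-along-suffix G ne r []            xs p           all = R-along G ne r xs p all
  R-along-suffix G ne r ((_ , t) ∷ d) xs (_ , _ , p) all = R-along-suffix G ne t d xs p all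

  All-⊇ : ∀ G xs → (∀ i → i ∈ G → All (Labelled i) xs) → All (λ e → G ⊆ proj₁ e) xs
  All-⊇ G []       all = []
  All-⊇ G (e ∷ xs) all =
    (λ {i} i∈G → head (all i i∈G)) ∷ All-⊇ G xs (λ i i∈G → tail (all i i∈G))

  distRel⇒R : ∀ G → Nonempty G → ∀ u v → distRel ∼ₙ G u v → R G (last u) (last v)
  distRel⇒R G ne (node r xs px) (node _ ys py) indist
    with indist (proj₁ ne) (proj₂ ne) | strip-prefix _≟Step_ xs ys
  ... | refl , _ | d , xs≡ , ys≡ =
    IsEquivalence.trans (R-equiv G ne)
      (IsEquivalence.sym (R-equiv G ne) (along xs≡ px (λ i i∈G → proj₁ (remainders i i∈G))))
      (along ys≡ py (λ i i∈G → proj₂ (remainders i i∈G)))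
    where
    remainders : ∀ i → i ∈ G →
      All (Labelled i) (proj₁ (strip _≟Step_ xs ys)) × All (Labelled i) (proj₂ (strip _≟Step_ xs ys))
    remainders i i∈G = Diverge⇒strip _≟Step_ xs ys (proj₂ (indist i i∈G))

    along : ∀ {zs rest} → zs ≡ d ++ rest → IsPath r zs →
            (∀ i → i ∈ G → All (Labelled i) rest) → R G (end r d) (end r zs)
    along {rest = rest} refl p labelled = R-along-suffix G ne r d rest p (All-⊇ G rest labelled)

  end-snoc : ∀ r xs (e : Step) → end r (xs ++ [ e ]) ≡ proj₂ e
  end-snoc r []             e = refl
  end-snoc r ((_ , t) ∷ xs) e = end-snoc t xs e

  IsPath-snoc : ∀ r xs G t → IsPath r xs → Nonempty G → R G (end r xs) t →
                IsPath r (xs ++ [ (G , t) ])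
  IsPath-snoc r []             G t _            ne rt = ne , rt , tt
  IsPath-snoc r ((H , s) ∷ xs) G t (a , b , p) ne rt = a , b , IsPath-snoc s xs G t p ne rt

  R⇒distRel : ∀ G → Nonempty G → ∀ u t → R G (last u) t →
              Σ Node λ v → last v ≡ t × distRel ∼ₙ G u v
  R⇒distRel G ne (node r xs p) t rt =
    node r (xs ++ [ (G , t) ]) (IsPath-snoc r xs G t p ne rt) ,
    end-snoc r xs (G , t) ,
    λ i i∈G → refl , fork xs [] [ (G , t) ] (sym (++-identityʳ xs)) refl [] (i∈G ∷ [])

  E' : EffFun n Node
  E' G u X = E G (last u) (λ t → X (root t))

  -- A minimal element X of E(∅)(last u) lifts to the length-0 paths ending in X.
  E'-minimal : ∀ u → Σ (StSet Node) λ X → E' ∅ₛ u X × (∀ Y → E' ∅ₛ u Y → Y ⊆ₚ X → X ⊆ₚ Y)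
  E'-minimal u with E6 (last u)
  ... | X , eX , minX =
    (λ q → q ≡ root (last q) × X (last q)) ,
    E4 _ (last u) X _ (λ t x → refl , x) eX ,
    λ { Y eY Y⊆ q (refl , x) → minX (λ t → Y (root t)) eY (λ t y → proj₂ (Y⊆ (root t) y)) _ x }

  E'-playable : TrulyPlayable E'
  E'-playable = record
    { E1 = λ G u → E1 G (last u)
    ; E2 = λ G u → E2 G (last u)
    ; E3 = λ u X → E3 (last u) (λ t → X (root t))
    ; E4 = λ G u X Y X⊆Y → E4 G (last u) _ _ (λ t → X⊆Y (root t))
    ; E5 = λ G₁ G₂ u X Y → E5 G₁ G₂ (last u) _ _
    ; E6 = E'-minimal }

  unravelled : ModelStr n Θ Node
  unravelled = record
    { inhabitant = root inhabitant
    ; E          = E'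
    ; ∼          = ∼ₙ
    ; V          = λ p u → V p (last u)
    ; ∼-equiv    = ∼-isEquivalence
    ; playable   = E'-playable }

  _⊨U_ : Node → Fm n Θ → Set
  u ⊨U φ = sat unravelled (distRel ∼ₙ) u φ

  -- Box-like modalities transfer along last whenever the two accessibility
  -- relations simulate each other through last.
  box-transfer : ∀ (relU : Node → Node → Set) (relP : S → S → Set) φ u →
    (∀ v → v ⊨U φ ⇔ P ⊨P φ at last v) →
    (∀ v → relU u v → relP (last u) (last v)) →
    (∀ t → relP (last u) t → Σ Node λ v → last v ≡ t × relU u v) →
    (∀ v → relU u v → v ⊨U φ) ⇔ (∀ t → relP (last u) t → P ⊨P φ at t)
  box-transfer relU relP φ u ih forth back = mk⇔
    (λ f t rt → let (v , v↦t , rv) = back t rt in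
                subst (P ⊨P φ at_) v↦t (to (ih v) (f v rv)))
    (λ f v rv → from (ih v) (f (last v) (forth v rv)))

  ∼ₙ⇔distRel : ∀ i u v → ∼ₙ i u v ⇔ distRel ∼ₙ ⁅ i ⁆ u v
  ∼ₙ⇔distRel i u v = mk⇔
    (λ r j j∈⁅i⁆ → subst (λ k → ∼ₙ k u v) (sym (x∈⁅y⁆⇒x≡y i j∈⁅i⁆)) r)
    (λ r → r i (x∈⁅x⁆ i))

  truth : ∀ φ u → u ⊨U φ ⇔ P ⊨P φ at last u
  truth (atom p)  u = mk⇔ (λ x → x) (λ x → x)
  truth (¬' φ)    u = mk⇔ (λ ¬φ φ' → ¬φ (from (truth φ u) φ')) (λ ¬φ φ' → ¬φ (to (truth φ u) φ'))
  truth (φ ∧' ψ)  u = mk⇔ (λ (a , b) → to (truth φ u) a , to (truth ψ u) b)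
                          (λ (a , b) → from (truth φ u) a , from (truth ψ u) b)
  truth ([ H ] φ) u = mk⇔ (E4 H (last u) _ _ (λ t → to (truth φ (root t))))
                          (E4 H (last u) _ _ (λ t → from (truth φ (root t))))
  truth (D G ne φ) u = box-transfer (distRel ∼ₙ G) (R G) φ u (truth φ)
    (distRel⇒R G ne u) (R⇒distRel G ne u)
  truth (K i φ)   u = box-transfer (∼ₙ i) (∼ i) φ u (truth φ)
    (λ v r → R-single-⊆ i _ _ (distRel⇒R ⁅ i ⁆ ne u v (to (∼ₙ⇔distRel i u v) r)))
    (λ t r → let (v , v↦t , rv) = R⇒distRel ⁅ i ⁆ ne u t (R-single-⊇ i _ t r)
             in v , v↦t , from (∼ₙ⇔distRel i u v) rv)
    where
    ne : Nonempty ⁅ i ⁆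
    ne = i , x∈⁅x⁆ i

theorem3 : {n : ℕ} {Θ : Set} (m : ℕ) (P : Pseudomodel n Θ (Fin m))
           (φ : Fm n Θ) (s : Fin m) → P ⊨P φ at s →
           Σ (Model n Θ) λ M → Σ (Model.St M) λ t → M ⊨M φ at t
theorem3 m P φ s s⊨φ =
  record { St = Node ; str = unravelled } , root s , from (truth φ (root s)) s⊨φ
  where open Unravelling Fin._≟_ P
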